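{- Let $p,q$ be patterns over $U$ with $\mathrm{lbs}(p)\cap\mathrm{lbs}(q)=\emptyset$. Then for every pattern $r$ over $U$, $p\oplus q\sim r$ if and only if $p\sim q\sqcup r$.
   Context: Let $U$ be a finite totally ordered set and $0\notin U$. A pattern over $U$ is a set $p$ of subsets of $U\cup\{0\}$ such that exactly one member $Z_p$ of $p$ (the zero-set) contains $0$. Let $\mathrm{lbs}(p)=\bigcup_{S\in p}S\setminus\{0\}$. For patterns $p,q$, the join $p\sqcup q$ is obtained by relating $S\in p$ and $T\in q$ whenever $S\cap T\neq\emptyset$, taking the equivalence closure of this relation on the members of $p$ and $q$, and forming the union of the members of each equivalence class. The union is $p\oplus q=(p\setminus\{Z_p\})\cup(q\setminus\{Z_q\})\cup\{Z_p\cup Z_q\}$. Patterns $p,q$ are consistent, $p\sim q$, if $p\sqcup q$ consists of a single set. -}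

module Defs where

open import Data.Nat using (ℕ; suc)
open import Data.Fin using (Fin; zero) renaming (suc to fsuc)
open import Data.Bool using (Bool; T)
open import Data.Fin.Subset using (Subset; _∈_; _∩_; _∪_; Nonempty)
open import Data.Product using (Σ; _×_; ∃)
open import Data.Sum using (_⊎_)
open import Relation.Binary.PropositionalEquality using (_≡_; _≢_)
open import Relation.Nullary using (¬_)
open import Function.Bundles using (_⇔_)

-- U = Fin n (a finite totally ordered set); U ∪ {0} is modelled by Fin (suc n),
-- where the new element 0 is 'zero' and u ∈ U is 'fsuc u'.
-- A subset of U ∪ {0}:
Sub : ℕ → Set
Sub n = Subset (suc n)

Family : ℕ → Set₁
Family n = Sub n → Set

record Pattern (n : ℕ) : Set where
  field
    mem       : Sub n → Bool
    zeroSet   : Sub n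
    zeroSet∈  : T (mem zeroSet)
    0∈zeroSet : zero ∈ zeroSet
    zeroSet!  : ∀ S → T (mem S) → zero ∈ S → S ≡ zeroSet
open Pattern public

⟦_⟧ : ∀ {n} → Pattern n → Family n
⟦ p ⟧ S = T (mem p S)

_∈lbs_ : ∀ {n} → Fin n → Pattern n → Set
u ∈lbs p = Σ (Sub _) λ S → ⟦ p ⟧ S × fsuc u ∈ S

-- Equivalence closure, on the members of a family F, of the relation
-- "S ∩ T ≠ ∅" (which is symmetric, so reflexive-transitive closure suffices).
data Conn {n : ℕ} (F : Family n) : Sub n → Sub n → Set where
  here : ∀ {S} → F S → Conn F S S
  step : ∀ {S T U} → Conn F S T → F U → Nonempty (T ∩ U) → Conn F S U

-- X ∈ p ⊔ q : X is the union of the members of some equivalence class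
-- (the relation being taken on the members of p and q together).
_⊔_ : ∀ {n} → Family n → Family n → Family n
(p ⊔ q) X = Σ (Sub _) λ S → (p S ⊎ q S) ×
              (∀ x → (x ∈ X) ⇔ (Σ (Sub _) λ R → Conn (λ V → p V ⊎ q V) S R × x ∈ R))

_⊕_ : ∀ {n} → Pattern n → Pattern n → Family n
(p ⊕ q) X = (⟦ p ⟧ X × X ≢ zeroSet p) ⊎ (⟦ q ⟧ X × X ≢ zeroSet q)
            ⊎ (X ≡ zeroSet p ∪ zeroSet q)

_∼_ : ∀ {n} → Family n → Family n → Set
p ∼ q = Σ (Sub _) λ X → (p ⊔ q) X × (∀ Y → (p ⊔ q) Y → Y ≡ X)

-- F ∼ G says that any two members of F ∪ G are joined by a chain of pairwise intersecting
-- members. Both p ⊕ q ∪ r and p ∪ (q ⊔ r) arise from p ∪ q ∪ r by merging groups of members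
-- that are already joined: Z_p with Z_q (they share 0), and each class of q ∪ r. Such a merge
-- neither creates nor destroys chains, so the three families are connected or not together.
-- Finiteness is used only to compute classes, by saturating a member under "add every
-- member meeting the current set".
{-# OPTIONS --safe #-}
module Submission where

open import Defs
open import Data.Nat using (ℕ; zero; suc; _+_; _≤_; _<_; s≤s)
open import Data.Nat.Properties using (m≤m+n; +-suc; +-monoʳ-≤; <-≤-trans; <⇒≱)
open import Data.Fin using (Fin) renaming (zero to fzero)
open import Data.Fin.Subset using (Subset; _∈_; _∩_; _∪_; _⊆_; _⊂_; Nonempty; ⊥; ∣_∣)
open import Data.Fin.Subset.Properties
  using (_∈?_; _⊂?_; nonempty?; anySubset?; ⊆-antisym; Empty-unique; ∣p∣≤n; p⊂q⇒∣p∣<∣q∣;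
         x∈p∩q⁺; x∈p∩q⁻; x∈p∪q⁻; p⊆p∪q; ∪-comm)
open import Data.Vec using (tabulate)
open import Data.Vec.Properties using (≡-dec; lookup∘tabulate; []=⇒lookup; lookup⇒[]=)
open import Data.Bool using () renaming (_≟_ to _≟ᵇ_)
open import Data.Bool.Properties using (T-≡)
open import Data.Product using (Σ; _×_; _,_; proj₁; proj₂)
open import Data.Sum using (_⊎_; inj₁; inj₂)
open import Data.Empty using (⊥-elim)
open import Level using (0ℓ)
open import Function using (_∘_; id)
open import Function.Bundles using (_⇔_; mk⇔; Equivalence)
open import Function.Properties.Equivalence using (⇔-setoid)
open import Relation.Binary.PropositionalEquality using (_≡_; refl; sym; trans; subst)
open import Relation.Binary.Definitions using (DecidableEquality)
open import Relation.Nullary using (¬_; yes; no)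
open import Relation.Nullary.Decidable
  using (⌊_⌋; T?; _×-dec_; _⊎-dec_; ¬?; map′; toWitness; fromWitness; decidable-stable)
open import Relation.Unary using (Decidable) renaming (_∪_ to _∪ᶠ_)
open import Relation.Unary.Properties using (_∪?_)
open Equivalence using (to; from)
import Relation.Binary.Reasoning.Setoid as SetoidReasoning

module _ {m : ℕ} {P : Fin m → Set} (P? : Decidable P) where

  subsetOf : Subset m
  subsetOf = tabulate (λ x → ⌊ P? x ⌋)

  ∈-subsetOf : ∀ {x} → x ∈ subsetOf ⇔ P x
  ∈-subsetOf {x} = mk⇔
    (λ x∈ → toWitness (from T-≡ (trans (sym (lookup∘tabulate _ x)) ([]=⇒lookup x∈))))
    (λ Px → lookup⇒[]= x _ (trans (lookup∘tabulate _ x) (to T-≡ (fromWitness Px))))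

infix 4 _≟ˢ_
_≟ˢ_ : ∀ {m} → DecidableEquality (Subset m)
_≟ˢ_ = ≡-dec _≟ᵇ_

Nonempty-∩-mono : ∀ {m} {A A′ B B′ : Subset m} → A ⊆ B → A′ ⊆ B′ →
                  Nonempty (A ∩ A′) → Nonempty (B ∩ B′)
Nonempty-∩-mono A⊆B A′⊆B′ (x , x∈A∩A′) =
  let (x∈A , x∈A′) = x∈p∩q⁻ _ _ x∈A∩A′
  in x , x∈p∩q⁺ (A⊆B x∈A , A′⊆B′ x∈A′)

module _ {n : ℕ} {F : Family n} where

  Conn-end : ∀ {S T} → Conn F S T → F T
  Conn-end (here FS)     = FS
  Conn-end (step _ FU _) = FU

  Conn-trans : ∀ {S T U} → Conn F S T → Conn F T U → Conn F S U
  Conn-trans c (here _)       = c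
  Conn-trans c (step d FU ne) = step (Conn-trans c d) FU ne

  Conn-meet : ∀ {S T} → F S → F T → Nonempty (S ∩ T) → Conn F S T
  Conn-meet FS = step (here FS)

  Conn-sym : ∀ {S T} → Conn F S T → Conn F T S
  Conn-sym (here FS) = here FS
  Conn-sym (step {T = T} {U} c FU (x , x∈T∩U)) =
    let (x∈T , x∈U) = x∈p∩q⁻ T U x∈T∩U
    in Conn-trans (Conn-meet FU (Conn-end c) (x , x∈p∩q⁺ (x∈U , x∈T))) (Conn-sym c)

  Conn-nonempty : ∀ {S T} → Conn F S T → Nonempty T → Nonempty S
  Conn-nonempty (here _)                 ne = ne
  Conn-nonempty (step c _ (x , x∈T∩U)) _ = Conn-nonempty c (x , proj₁ (x∈p∩q⁻ _ _ x∈T∩U))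

Conn-mono : ∀ {n} {F G : Family n} → (∀ {S} → F S → G S) →
            ∀ {S T} → Conn F S T → Conn G S T
Conn-mono F⊆G (here FS)      = here (F⊆G FS)
Conn-mono F⊆G (step c FU ne) = step (Conn-mono F⊆G c) (F⊆G FU) ne

Linked : ∀ {n} → Family n → Sub n → Fin (suc n) → Set
Linked {n} F S x = Σ (Sub n) λ R → Conn F S R × x ∈ R

-- F ⊔ G and F ∼ G unfold to statements about Class (F ∪ᶠ G).
Class : ∀ {n} → Family n → Sub n → Sub n → Set
Class F S X = ∀ x → x ∈ X ⇔ Linked F S x

Spans : ∀ {n} → Family n → Sub n → Sub n → Set
Spans F A B = A ⊆ B × (∀ {x} → x ∈ B → Linked F A x)

Connected : ∀ {n} → Family n → Set
Connected F = ∀ {S T} → F S → F T → Conn F S T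

module _ {n : ℕ} {F : Family n} where

  Linked⇒Conn : ∀ {S R x} → Linked F S x → F R → x ∈ R → Conn F S R
  Linked⇒Conn (R′ , c , x∈R′) FR x∈R = step c FR (_ , x∈p∩q⁺ (x∈R′ , x∈R))

  Linked-both⇒Conn : ∀ {A B x} → Linked F A x → Linked F B x → Conn F A B
  Linked-both⇒Conn l (R , c , x∈R) = Conn-trans (Linked⇒Conn l (Conn-end c) x∈R) (Conn-sym c)

  Linked-nonempty : ∀ {A x} → Linked F A x → Nonempty A
  Linked-nonempty (_ , c , x∈R) = Conn-nonempty c (_ , x∈R)

  Class-unique : ∀ {S X Y} → Class F S X → Class F S Y → X ≡ Y
  Class-unique clsX clsY =
    ⊆-antisym (λ x∈X → from (clsY _) (to (clsX _) x∈X))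
              (λ x∈Y → from (clsX _) (to (clsY _) x∈Y))

  Spans-refl : ∀ {A} → F A → Spans F A A
  Spans-refl FA = id , λ x∈A → _ , here FA , x∈A

  Class⇒Spans : ∀ {S X} → F S → Class F S X → Spans F S X
  Class⇒Spans FS cls = (λ x∈S → from (cls _) (_ , here FS , x∈S)) , (λ x∈X → to (cls _) x∈X)

  Spans-∪ : ∀ {A B} → F A → F B → Nonempty (A ∩ B) → Spans F A (A ∪ B)
  Spans-∪ {A} {B} FA FB ne = p⊆p∪q B , λ x∈A∪B → linked (x∈p∪q⁻ A B x∈A∪B)
    where
    linked : ∀ {x} → x ∈ A ⊎ x ∈ B → Linked F A x
    linked (inj₁ x∈A) = A , here FA , x∈A
    linked (inj₂ x∈B) = B , Conn-meet FA FB ne , x∈B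

  Spans-empty : ∀ {A B} → Spans F A B → ¬ Nonempty A → B ≡ ⊥
  Spans-empty (_ , B⊆Linked) A-empty = Empty-unique (A-empty ∘ Linked-nonempty ∘ B⊆Linked ∘ proj₂)

  Spans-common-set : ∀ {A A′ B} → F A → F A′ → Spans F A B → Spans F A′ B → Conn F A A′
  Spans-common-set {A} {A′} {B} FA FA′ sA sA′ with nonempty? B
  ... | yes (x , x∈B) = Linked-both⇒Conn (proj₂ sA x∈B) (proj₂ sA′ x∈B)
  ... | no B-empty    = subst (Conn F A) A≡A′ (here FA)
    where
    empty : ∀ {C} → C ⊆ B → C ≡ ⊥
    empty C⊆B = Empty-unique (λ (x , x∈C) → B-empty (x , C⊆B x∈C))
    A≡A′ : A ≡ A′
    A≡A′ = trans (empty (proj₁ sA)) (sym (empty (proj₁ sA′)))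

Spans-mono : ∀ {n} {F G : Family n} → (∀ {S} → F S → G S) →
             ∀ {A B} → Spans F A B → Spans G A B
Spans-mono F⊆G (A⊆B , B⊆Linked) = A⊆B , λ x∈B →
  let (R , c , x∈R) = B⊆Linked x∈B in R , Conn-mono F⊆G c , x∈R

Spans-common-anchor : ∀ {n} {F G : Family n} {A B B′} → G B → G B′ →
                      Spans F A B → Spans F A B′ → Conn G B B′
Spans-common-anchor {A = A} {B} {B′} GB GB′ sB sB′ with nonempty? A
... | yes (x , x∈A) = Conn-meet GB GB′ (x , x∈p∩q⁺ (proj₁ sB x∈A , proj₁ sB′ x∈A))
... | no A-empty    =
  subst (Conn _ B) (trans (Spans-empty sB A-empty) (sym (Spans-empty sB′ A-empty))) (here GB)

Conn-transport : ∀ {n} {F G : Family n} (Rel : Sub n → Sub n → Set) →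
  (∀ {A} → F A → Σ (Sub n) (Rel A)) →
  (∀ {A B B′} → Rel A B → Rel A B′ → Conn G B B′) →
  (∀ {A A′ B B′} → Rel A B → Rel A′ B′ → Nonempty (A ∩ A′) → Conn G B B′) →
  ∀ {A A′ B B′} → Conn F A A′ → Rel A B → Rel A′ B′ → Conn G B B′
Conn-transport Rel total same meet (here _)       rB rB′ = same rB rB′
Conn-transport Rel total same meet (step c _ ne) rB rB′ =
  let (E , rE) = total (Conn-end c)
  in Conn-trans (Conn-transport Rel total same meet c rB rE) (meet rE rB′ ne)

-- G arises from F by merging groups of F-connected members.
record Coarsening {n : ℕ} (F G : Family n) : Set where
  field
    merge  : ∀ {A} → F A → Σ (Sub n) λ B → G B × Spans F A B
    anchor : ∀ {B} → G B → Σ (Sub n) λ A → F A × Spans F A B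

module _ {n : ℕ} {F G : Family n} (coarse : Coarsening F G) where
  open Coarsening coarse

  Coarsening-connected : Connected F ⇔ Connected G
  Coarsening-connected = mk⇔ fine⇒coarse coarse⇒fine
    where
    fine⇒coarse : Connected F → Connected G
    fine⇒coarse conF GB GB′ =
      let (A , FA , sB) = anchor GB ; (A′ , FA′ , sB′) = anchor GB′
      in Conn-transport (λ A B → G B × Spans F A B) merge
           (λ (GE , sE) (GE′ , sE′) → Spans-common-anchor GE GE′ sE sE′)
           (λ (GE , sE) (GE′ , sE′) →
              Conn-meet GE GE′ ∘ Nonempty-∩-mono (proj₁ sE) (proj₁ sE′))
           (conF FA FA′) (GB , sB) (GB′ , sB′)

    coarse⇒fine : Connected G → Connected F
    coarse⇒fine conG FA FA′ =
      let (B , GB , sB) = merge FA ; (B′ , GB′ , sB′) = merge FA′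
      in Conn-transport (λ B A → F A × Spans F A B) anchor
           (λ (FD , sD) (FD′ , sD′) → Spans-common-set FD FD′ sD sD′)
           (λ (_ , sD) (_ , sD′) (x , x∈E∩E′) →
              let (x∈E , x∈E′) = x∈p∩q⁻ _ _ x∈E∩E′
              in Linked-both⇒Conn (proj₂ sD x∈E) (proj₂ sD′ x∈E′))
           (conG GB GB′) (FA , sB) (FA′ , sB′)

module Closure {n : ℕ} {F : Family n} (F? : Decidable F) where

  Grows : Sub n → Fin (suc n) → Set
  Grows Y x = x ∈ Y ⊎ (Σ (Sub n) λ R → F R × Nonempty (R ∩ Y) × x ∈ R)

  grows? : ∀ Y → Decidable (Grows Y)
  grows? Y x = x ∈? Y ⊎-dec anySubset? λ R → F? R ×-dec nonempty? (R ∩ Y) ×-dec x ∈? R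

  grow : Sub n → Sub n
  grow Y = subsetOf (grows? Y)

  ∈-grow : ∀ {Y x} → x ∈ grow Y ⇔ Grows Y x
  ∈-grow {Y} = ∈-subsetOf (grows? Y)

  Y⊆grow : ∀ {Y} → Y ⊆ grow Y
  Y⊆grow x∈Y = from ∈-grow (inj₁ x∈Y)

  grow-spans : ∀ {S Y} → Spans F S Y → Spans F S (grow Y)
  grow-spans {S} {Y} (S⊆Y , Y⊆Linked) = Y⊆grow ∘ S⊆Y , linked ∘ to ∈-grow
    where
    linked : ∀ {x} → Grows Y x → Linked F S x
    linked (inj₁ x∈Y)                       = Y⊆Linked x∈Y
    linked (inj₂ (R , FR , (y , y∈R∩Y) , x∈R)) =
      let (y∈R , y∈Y) = x∈p∩q⁻ R Y y∈R∩Y in R , Linked⇒Conn (Y⊆Linked y∈Y) FR y∈R , x∈R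

  Conn-⊆-closed : ∀ {S Y R} → S ⊆ Y → grow Y ⊆ Y → Conn F S R → R ⊆ Y
  Conn-⊆-closed S⊆Y closed (here _) = S⊆Y
  Conn-⊆-closed S⊆Y closed (step c FU (y , y∈T∩U)) x∈U =
    let (y∈T , y∈U) = x∈p∩q⁻ _ _ y∈T∩U
        y∈Y = Conn-⊆-closed S⊆Y closed c y∈T
    in closed (from ∈-grow (inj₂ (_ , FU , (y , x∈p∩q⁺ (y∈U , y∈Y)) , x∈U)))

  grow-closed : ∀ {Y} → ¬ Y ⊂ grow Y → grow Y ⊆ Y
  grow-closed {Y} Y⊄grow {x} x∈grow =
    decidable-stable (x ∈? Y) λ x∉Y → Y⊄grow (Y⊆grow , x , x∈grow , x∉Y)

  saturate : ℕ → Sub n → Sub n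
  saturate zero    Y = Y
  saturate (suc k) Y with Y ⊂? grow Y
  ... | yes _ = saturate k (grow Y)
  ... | no  _ = Y

  saturate-spans : ∀ {S} k {Y} → Spans F S Y → Spans F S (saturate k Y)
  saturate-spans zero        s = s
  saturate-spans (suc k) {Y} s with Y ⊂? grow Y
  ... | yes _ = saturate-spans k (grow-spans s)
  ... | no  _ = s

  -- Every round that does not stop adds a point, and there are only suc n points.
  saturate-closed : ∀ k {Y} → suc n < k + ∣ Y ∣ → grow (saturate k Y) ⊆ saturate k Y
  saturate-closed zero    {Y} fuel = ⊥-elim (<⇒≱ fuel (∣p∣≤n Y))
  saturate-closed (suc k) {Y} fuel with Y ⊂? grow Y
  ... | yes Y⊂grow = saturate-closed k
    (<-≤-trans fuel (subst (_≤ k + ∣ grow Y ∣) (+-suc k ∣ Y ∣)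
                           (+-monoʳ-≤ k (p⊂q⇒∣p∣<∣q∣ Y⊂grow))))
  ... | no  Y⊄grow = grow-closed Y⊄grow

  closure : Sub n → Sub n
  closure = saturate (2 + n)

  closure-class : ∀ {S} → F S → Class F S (closure S)
  closure-class {S} FS x =
    mk⇔ (proj₂ spans) (λ (R , c , x∈R) → Conn-⊆-closed (proj₁ spans) closed c x∈R)
    where
    spans : Spans F S (closure S)
    spans = saturate-spans (2 + n) (Spans-refl FS)
    closed : grow (closure S) ⊆ closure S
    closed = saturate-closed (2 + n) {S} (s≤s (m≤m+n (suc n) ∣ S ∣))

module _ {n : ℕ} {F : Family n} (F? : Decidable F) where

  InMember : Fin (suc n) → Set
  InMember x = Σ (Sub n) λ R → F R × x ∈ R

  inMember? : Decidable InMember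
  inMember? x = anySubset? λ R → F? R ×-dec x ∈? R

  ⋃members : Sub n
  ⋃members = subsetOf inMember?

  ∈-⋃members : ∀ {x} → x ∈ ⋃members ⇔ InMember x
  ∈-⋃members = ∈-subsetOf inMember?

module _ {n : ℕ} {F G : Family n} (F∪G? : Decidable (F ∪ᶠ G)) where
  open Closure F∪G?

  ⊔-decidable : Decidable (F ⊔ G)
  ⊔-decidable X = map′
    (λ (S , FGS , X≡) → S , FGS , subst (Class _ S) (sym X≡) (closure-class FGS))
    (λ (S , FGS , cls) → S , FGS , Class-unique cls (closure-class FGS))
    (anySubset? λ S → F∪G? S ×-dec X ≟ˢ closure S)

  ∼⇔Connected : ∀ {b} → (F ∪ᶠ G) b → (F ∼ G) ⇔ Connected (F ∪ᶠ G)
  ∼⇔Connected {b} FGb = mk⇔ single⇒connected connected⇒single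
    where
    single⇒connected : F ∼ G → Connected (F ∪ᶠ G)
    single⇒connected (X , _ , unique) FGS FGT = Spans-common-set FGS FGT (spans FGS) (spans FGT)
      where
      spans : ∀ {S} → (F ∪ᶠ G) S → Spans (F ∪ᶠ G) S X
      spans FGS = Class⇒Spans FGS
        (subst (Class _ _) (unique _ (_ , FGS , closure-class FGS)) (closure-class FGS))

    connected⇒single : Connected (F ∪ᶠ G) → F ∼ G
    connected⇒single conn =
      ⋃members F∪G? , (b , FGb , class FGb) , λ Y (S , FGS , clsY) → Class-unique clsY (class FGS)
      where
      class : ∀ {S} → (F ∪ᶠ G) S → Class (F ∪ᶠ G) S (⋃members F∪G?)
      class FGS x = mk⇔
        (λ x∈⋃ → let (R , FGR , x∈R) = to (∈-⋃members F∪G?) x∈⋃ in R , conn FGS FGR , x∈R)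
        (λ (R , c , x∈R) → from (∈-⋃members F∪G?) (R , Conn-end c , x∈R))

⟦_⟧? : ∀ {n} (p : Pattern n) → Decidable ⟦ p ⟧
⟦ p ⟧? S = T? (mem p S)

⊕-decidable : ∀ {n} (p q : Pattern n) → Decidable (p ⊕ q)
⊕-decidable p q X =
  (⟦ p ⟧? X ×-dec ¬? (X ≟ˢ zeroSet p)) ⊎-dec (⟦ q ⟧? X ×-dec ¬? (X ≟ˢ zeroSet q))
  ⊎-dec X ≟ˢ zeroSet p ∪ zeroSet q

⊕-coarsening : ∀ {n} (p q : Pattern n) (F : Family n) →
               Coarsening (⟦ p ⟧ ∪ᶠ ⟦ q ⟧ ∪ᶠ F) ((p ⊕ q) ∪ᶠ F)
⊕-coarsening {n} p q F = record { merge = merge ; anchor = anchor }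
  where
  H : Family n
  H = ⟦ p ⟧ ∪ᶠ ⟦ q ⟧ ∪ᶠ F
  Zp Zq : Sub n
  Zp = zeroSet p
  Zq = zeroSet q

  Zp∈H : H Zp
  Zp∈H = inj₁ (zeroSet∈ p)
  Zq∈H : H Zq
  Zq∈H = inj₂ (inj₁ (zeroSet∈ q))

  Zp-spans : Spans H Zp (Zp ∪ Zq)
  Zp-spans = Spans-∪ Zp∈H Zq∈H (fzero , x∈p∩q⁺ (0∈zeroSet p , 0∈zeroSet q))
  Zq-spans : Spans H Zq (Zp ∪ Zq)
  Zq-spans = subst (Spans H Zq) (∪-comm Zq Zp)
                   (Spans-∪ Zq∈H Zp∈H (fzero , x∈p∩q⁺ (0∈zeroSet q , 0∈zeroSet p)))

  merge : ∀ {A} → H A → Σ (Sub n) λ B → ((p ⊕ q) ∪ᶠ F) B × Spans H A B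
  merge {A} (inj₁ pA) with A ≟ˢ Zp
  ... | yes refl = Zp ∪ Zq , inj₁ (inj₂ (inj₂ refl)) , Zp-spans
  ... | no A≢Zp  = A , inj₁ (inj₁ (pA , A≢Zp)) , Spans-refl (inj₁ pA)
  merge {A} (inj₂ (inj₁ qA)) with A ≟ˢ Zq
  ... | yes refl = Zp ∪ Zq , inj₁ (inj₂ (inj₂ refl)) , Zq-spans
  ... | no A≢Zq  = A , inj₁ (inj₂ (inj₁ (qA , A≢Zq))) , Spans-refl (inj₂ (inj₁ qA))
  merge {A} (inj₂ (inj₂ FA)) = A , inj₂ FA , Spans-refl (inj₂ (inj₂ FA))

  anchor : ∀ {B} → ((p ⊕ q) ∪ᶠ F) B → Σ (Sub n) λ A → H A × Spans H A B
  anchor {B} (inj₁ (inj₁ (pB , _)))        = B , inj₁ pB , Spans-refl (inj₁ pB)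
  anchor {B} (inj₁ (inj₂ (inj₁ (qB , _)))) = B , inj₂ (inj₁ qB) , Spans-refl (inj₂ (inj₁ qB))
  anchor     (inj₁ (inj₂ (inj₂ refl)))     = Zp , Zp∈H , Zp-spans
  anchor {B} (inj₂ FB)                     = B , inj₂ (inj₂ FB) , Spans-refl (inj₂ (inj₂ FB))

⊔-coarsening : ∀ {n} {F G K : Family n} → Decidable (G ∪ᶠ K) →
               Coarsening (F ∪ᶠ G ∪ᶠ K) (F ∪ᶠ (G ⊔ K))
⊔-coarsening {n} {F} {G} {K} G∪K? = record { merge = merge ; anchor = anchor }
  where
  open Closure G∪K?

  H : Family n
  H = F ∪ᶠ G ∪ᶠ K

  class-spans : ∀ {S X} → (G ∪ᶠ K) S → Class (G ∪ᶠ K) S X → Spans H S X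
  class-spans GKS cls = Spans-mono inj₂ (Class⇒Spans GKS cls)

  merge : ∀ {A} → H A → Σ (Sub n) λ B → (F ∪ᶠ (G ⊔ K)) B × Spans H A B
  merge {A} (inj₁ FA)  = A , inj₁ FA , Spans-refl (inj₁ FA)
  merge {A} (inj₂ GKA) =
    closure A , inj₂ (A , GKA , closure-class GKA) , class-spans GKA (closure-class GKA)

  anchor : ∀ {B} → (F ∪ᶠ (G ⊔ K)) B → Σ (Sub n) λ A → H A × Spans H A B
  anchor {B} (inj₁ FB)              = B , inj₁ FB , Spans-refl (inj₁ FB)
  anchor     (inj₂ (S , GKS , cls)) = S , inj₂ GKS , class-spans GKS cls

lemma4p23 : ∀ {n} (p q : Pattern n) →
    (∀ (u : Fin n) → ¬ (u ∈lbs p × u ∈lbs q)) →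
    ∀ (r : Pattern n) → ((p ⊕ q) ∼ ⟦ r ⟧) ⇔ (⟦ p ⟧ ∼ (⟦ q ⟧ ⊔ ⟦ r ⟧))
lemma4p23 p q _ r = begin
  (p ⊕ q) ∼ ⟦ r ⟧                      ≈⟨ ∼⇔Connected p⊕q∪r? (inj₁ (inj₂ (inj₂ refl))) ⟩
  Connected ((p ⊕ q) ∪ᶠ ⟦ r ⟧)         ≈⟨ Coarsening-connected (⊕-coarsening p q ⟦ r ⟧) ⟨
  Connected (⟦ p ⟧ ∪ᶠ ⟦ q ⟧ ∪ᶠ ⟦ r ⟧)  ≈⟨ Coarsening-connected (⊔-coarsening q∪r?) ⟩
  Connected (⟦ p ⟧ ∪ᶠ (⟦ q ⟧ ⊔ ⟦ r ⟧)) ≈⟨ ∼⇔Connected p∪q⊔r? (inj₁ (zeroSet∈ p)) ⟨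
  ⟦ p ⟧ ∼ (⟦ q ⟧ ⊔ ⟦ r ⟧)              ∎
  where
  open SetoidReasoning (⇔-setoid 0ℓ)
  q∪r? : Decidable (⟦ q ⟧ ∪ᶠ ⟦ r ⟧)
  q∪r? = ⟦ q ⟧? ∪? ⟦ r ⟧?
  p⊕q∪r? : Decidable ((p ⊕ q) ∪ᶠ ⟦ r ⟧)
  p⊕q∪r? = ⊕-decidable p q ∪? ⟦ r ⟧?
  p∪q⊔r? : Decidable (⟦ p ⟧ ∪ᶠ (⟦ q ⟧ ⊔ ⟦ r ⟧))
  p∪q⊔r? = ⟦ p ⟧? ∪? ⊔-decidable q∪r?
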